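{- Let $x$ be a positive integer. The system $x_1+1=x,\quad x!=x_2,\quad x_2+1=x_3,\quad x_1!=x_4,\quad x_2!=x_5,\quad x\not\mid x_4,\quad x_3\not\mid x_5$ is solvable in positive integers $x_1,x_2,x_3,x_4,x_5$ if and only if both $x$ and $x!+1$ are prime. In this case, the solution is unique and is given by $x_1=x-1$, $x_2=x!$, $x_3=x!+1$, $x_4=(x-1)!$, $x_5=(x!)!$.
   Context: $a\not\mid b$ means that $a$ does not divide $b$. -}

module Defs where

open import Data.Nat using (ℕ; _+_; _∸_; _!; _<_)
open import Data.Nat.Divisibility using (_∤_)
open import Data.Product using (_×_)
open import Relation.Binary.PropositionalEquality using (_≡_)

System : ℕ → ℕ → ℕ → ℕ → ℕ → ℕ → Set
System x x₁ x₂ x₃ x₄ x₅ =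
  (0 < x₁) × (0 < x₂) × (0 < x₃) × (0 < x₄) × (0 < x₅) ×
  (x₁ + 1 ≡ x) × (x ! ≡ x₂) × (x₂ + 1 ≡ x₃) × (x₁ ! ≡ x₄) ×
  (x₂ ! ≡ x₅) × (x ∤ x₄) × (x₃ ∤ x₅)

module Submission where

-- The system says exactly that x = x₁ + 1 with x₁ ≥ 1, that all other
-- unknowns are the prescribed factorials, and that
--     x ∤ (x - 1)!     and     x! + 1 ∤ (x!)! .
-- So everything rests on the converse of Wilson's theorem in the form
--     for n ≥ 2:  n ∤ (n - 1)!  ⇔  n is prime or n = 4.
-- The direction "⇐ for primes" holds because a prime dividing m! must
-- divide one of 1, …, m.  For "⇒", a composite n = q·d (1 < q, d < n)
-- divides (n - 1)!: if q ≠ d the two distinct factors both occur in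
-- (n - 1)!; if q = d > 2 then d and 2d are distinct factors of
-- (n - 1)! and d² ∣ d·2d; only q = d = 2, i.e. n = 4, escapes.
-- Applied to x! + 1 this gives primality (x! + 1 = 4 would mean x! = 3,
-- impossible as 2 ∣ x!); applied to x it gives x prime or x = 4, and
-- x = 4 is excluded because 4! + 1 = 25 is not prime.

open import Defs
open import Data.Nat
  using (ℕ; zero; suc; _+_; _∸_; _*_; _!; _<_; _≤_; z≤n; s≤s; s≤s⁻¹; _≟_; NonZero; >-nonZero; nonTrivial⇒n>1)
open import Data.Nat.Properties
open import Data.Nat.Divisibility
open import Data.Nat.Primality
  using (Prime; Composite; composite; composite-≢; composite⇒¬prime; euclidsLemma; ¬prime[0]; ¬prime[1]; prime?; ¬prime⇒composite)
open import Data.Product using (_×_; _,_; ∃-syntax)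
open import Data.Sum using (_⊎_; inj₁; inj₂)
open import Function using (_∘_)
open import Relation.Nullary using (yes; no; ¬_; contradiction)
open import Relation.Nullary.Decidable using (from-no)
open import Relation.Binary using (tri<; tri≈; tri>)
open import Relation.Binary.PropositionalEquality using (_≡_; _≢_; refl; sym; trans; cong; cong₂; subst)

divisor∣factorial : ∀ {k n} → 1 ≤ k → k ≤ n → k ∣ n !
divisor∣factorial {suc j} _ k≤n = ∣-trans (m∣m*n (j !)) (m≤n⇒m!∣n! k≤n)

product∣factorial : ∀ {a b n} → 1 ≤ a → a < b → b ≤ n → a * b ∣ n !
product∣factorial {a} {suc c} {n} 1≤a (s≤s a≤c) b≤n = begin
  a * suc c    ∣⟨ *-monoˡ-∣ (suc c) (divisor∣factorial 1≤a a≤c) ⟩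
  c ! * suc c  ≡⟨ *-comm (c !) (suc c) ⟩
  suc c !      ∣⟨ m≤n⇒m!∣n! b≤n ⟩
  n !          ∎
  where open ∣-Reasoning

distinct-product∣factorial : ∀ {a b n} → 1 ≤ a → 1 ≤ b → a ≢ b → a ≤ n → b ≤ n → a * b ∣ n !
distinct-product∣factorial {a} {b} {n} 1≤a 1≤b a≢b a≤n b≤n with <-cmp a b
... | tri< a<b _ _ = product∣factorial 1≤a a<b b≤n
... | tri≈ _ a≡b _ = contradiction a≡b a≢b
... | tri> _ _ b<a = subst (_∣ n !) (*-comm b a) (product∣factorial 1≤b b<a a≤n)

square∣factorial : ∀ {d m} → 2 < d → d * d ≤ suc m → d * d ∣ m !
square∣factorial {d} {m} 2<d d²≤1+m = begin
  d * d        ∣⟨ *-monoʳ-∣ d (n∣m*n 2) ⟩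
  d * (2 * d)  ∣⟨ product∣factorial 1≤d d<2d 2d≤m ⟩
  m !          ∎
  where
  open ∣-Reasoning
  1≤d : 1 ≤ d
  1≤d = <-trans (s≤s z≤n) (<-trans (n<1+n 1) 2<d)
  instance
    d≢0 : NonZero d
    d≢0 = >-nonZero 1≤d
  d<2d : d < 2 * d
  d<2d = subst (d <_) (*-comm d 2) (m<m*n d 2 (n<1+n 1))
  2d≤m : 2 * d ≤ m
  2d≤m = s≤s⁻¹ (<-≤-trans (*-monoˡ-< d 2<d) d²≤1+m)

composite∣factorial : ∀ {m} → Composite (suc m) → suc m ≢ 4 → suc m ∣ m !
composite∣factorial {m} (composite {d} d<n d∣n) n≢4 = subst (_∣ m !) (sym n≡q*d) q*d∣m!
  where
  q : ℕ
  q = quotient d∣n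
  n≡q*d : suc m ≡ q * d
  n≡q*d = m∣n⇒n≡quotient*m d∣n
  1<q : 1 < q
  1<q = quotient>1 d∣n d<n
  1<d : 1 < d
  1<d = nonTrivial⇒n>1 d
  instance
    q≢0 : NonZero q
    q≢0 = >-nonZero (<-trans (s≤s z≤n) 1<q)
  q<n : q < suc m
  q<n = subst (q <_) (sym n≡q*d) (m<m*n q d 1<d)
  q*d∣m! : q * d ∣ m !
  q*d∣m! with q ≟ d
  ... | no q≢d = distinct-product∣factorial (<⇒≤ 1<q) (<⇒≤ 1<d) q≢d (s≤s⁻¹ q<n) (s≤s⁻¹ d<n)
  ... | yes q≡d = subst (λ r → r * d ∣ m !) (sym q≡d) (square∣factorial 2<d d²≤n)
    where
    d≢2 : d ≢ 2
    d≢2 d≡2 = n≢4 (trans n≡q*d (cong₂ _*_ (trans q≡d d≡2) d≡2))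
    2<d : 2 < d
    2<d = ≤∧≢⇒< 1<d (d≢2 ∘ sym)
    d²≤n : d * d ≤ suc m
    d²≤n = ≤-reflexive (sym (subst (λ r → suc m ≡ r * d) q≡d n≡q*d))

∤factorial⇒prime⊎4 : ∀ {m} → 1 ≤ m → suc m ∤ m ! → Prime (suc m) ⊎ suc m ≡ 4
∤factorial⇒prime⊎4 {suc k} _ n∤ with prime? (suc (suc k)) | suc (suc k) ≟ 4
... | yes n-prime | _       = inj₁ n-prime
... | no _        | yes n≡4 = inj₂ n≡4
... | no ¬n-prime | no n≢4  = contradiction (composite∣factorial (¬prime⇒composite ¬n-prime) n≢4) n∤

wilson-converse : ∀ {m n} → m + 1 ≡ n → 1 ≤ m → n ∤ m ! → Prime n ⊎ n ≡ 4
wilson-converse {m} refl 1≤m n∤m! =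
  subst (λ n → Prime n ⊎ n ≡ 4) (+-comm 1 m)
    (∤factorial⇒prime⊎4 1≤m (subst (_∤ m !) (+-comm m 1) n∤m!))

-- A prime p does not divide m! for m < p, since it would divide a factor.
prime∤factorial : ∀ {p m} → Prime p → m < p → p ∤ m !
prime∤factorial {m = zero}  p-prime _ p∣1 = ¬prime[1] (subst Prime (∣1⇒≡1 p∣1) p-prime)
prime∤factorial {m = suc m} p-prime m<p p∣m!
  with euclidsLemma (suc m) (m !) p-prime p∣m!
... | inj₁ p∣1+m = <⇒≱ m<p (∣⇒≤ p∣1+m)
... | inj₂ p∣m!′ = prime∤factorial p-prime (<-trans (n<1+n m) m<p) p∣m!′

-- No factorial equals 3: 0! = 1! = 1, and n! is even for n ≥ 2.
factorial≢3 : ∀ n → n ! ≢ 3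
factorial≢3 zero          ()
factorial≢3 (suc zero)    ()
factorial≢3 (suc (suc n)) n!≡3 =
  from-no (2 ∣? 3) (subst (2 ∣_) n!≡3 (divisor∣factorial {n = suc (suc n)} (s≤s z≤n) (s≤s (s≤s z≤n))))

¬prime[25] : ¬ Prime 25
¬prime[25] = composite⇒¬prime (composite-≢ 5 (λ ()) (divides 5 refl))

system⇒canonical : ∀ {x x₁ x₂ x₃ x₄ x₅} → System x x₁ x₂ x₃ x₄ x₅ →
  (x₁ ≡ x ∸ 1) × (x₂ ≡ x !) × (x₃ ≡ x ! + 1) × (x₄ ≡ (x ∸ 1) !) × (x₅ ≡ (x !) !)
system⇒canonical {x₁ = x₁} (_ , _ , _ , _ , _ , refl , refl , refl , refl , refl , _ , _) =
  x₁≡x∸1 , refl , refl , cong _! x₁≡x∸1 , refl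
  where
  x₁≡x∸1 : x₁ ≡ x₁ + 1 ∸ 1
  x₁≡x∸1 = sym (m+n∸n≡m x₁ 1)

-- A solvable system forces x and x! + 1 to be prime: Wilson's converse
-- leaves x! + 1 = 4 (impossible, x! ≠ 3) and x = 4 (then x! + 1 = 25).
system⇒primes : ∀ {x x₁ x₂ x₃ x₄ x₅} → System x x₁ x₂ x₃ x₄ x₅ → Prime x × Prime (x ! + 1)
system⇒primes {x} (1≤x₁ , _ , _ , _ , _ , x₁+1≡x , refl , refl , refl , refl , x∤x₁! , x₃∤x₅)
  with wilson-converse refl (1≤n! x) x₃∤x₅ | wilson-converse x₁+1≡x 1≤x₁ x∤x₁!
... | inj₂ x!+1≡4      | _            = contradiction (+-cancelʳ-≡ 1 (x !) 3 x!+1≡4) (factorial≢3 x)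
... | inj₁ x!+1-prime | inj₁ x-prime = x-prime , x!+1-prime
... | inj₁ x!+1-prime | inj₂ x≡4     =
  contradiction (subst (λ n → Prime (n ! + 1)) x≡4 x!+1-prime) ¬prime[25]

primes⇒canonical-solution : ∀ {x} → Prime x → Prime (x ! + 1) →
  System x (x ∸ 1) (x !) (x ! + 1) ((x ∸ 1) !) ((x !) !)
primes⇒canonical-solution {zero}        x-prime _ = contradiction x-prime ¬prime[0]
primes⇒canonical-solution {suc zero}    x-prime _ = contradiction x-prime ¬prime[1]
primes⇒canonical-solution {x@(suc (suc k))} x-prime x!+1-prime =
  s≤s z≤n , 1≤n! x , ≤-trans (1≤n! x) (m≤m+n (x !) 1) , 1≤n! (suc k) , 1≤n! (x !) ,
  +-comm (suc k) 1 , refl , refl , refl , refl ,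
  prime∤factorial x-prime (n<1+n (suc k)) ,
  prime∤factorial x!+1-prime (m<m+n (x !) (s≤s z≤n))

lemma5 : (x : ℕ) → 0 < x →
    ((∃[ x₁ ] ∃[ x₂ ] ∃[ x₃ ] ∃[ x₄ ] ∃[ x₅ ] System x x₁ x₂ x₃ x₄ x₅)
      → Prime x × Prime (x ! + 1))
    × ((Prime x × Prime (x ! + 1))
      → ∃[ x₁ ] ∃[ x₂ ] ∃[ x₃ ] ∃[ x₄ ] ∃[ x₅ ] System x x₁ x₂ x₃ x₄ x₅)
    × (∀ x₁ x₂ x₃ x₄ x₅ → System x x₁ x₂ x₃ x₄ x₅ →
        (x₁ ≡ x ∸ 1) × (x₂ ≡ x !) × (x₃ ≡ x ! + 1)
          × (x₄ ≡ (x ∸ 1) !) × (x₅ ≡ (x !) !))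
lemma5 x _ =
    (λ (_ , _ , _ , _ , _ , solution) → system⇒primes solution)
  , (λ (x-prime , x!+1-prime) →
       _ , _ , _ , _ , _ , primes⇒canonical-solution x-prime x!+1-prime)
  , (λ _ _ _ _ _ → system⇒canonical)
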